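{- Let $k \geq 2$ and let $\mathcal{T}$ be a tree on $n$ taxa containing a split $A|B$ with $k \leq |B| \leq 2(k-1)$. Let $B = B_1 \cup B_2$ be any partition with $|B_1| = k-1$ (so $1 \leq |B_2| \leq k-1$), and let $\mathcal{T}'$ be the tree on the same $n$ taxa obtained from $\mathcal{T}$ by replacing the pendant $B$ subtree with a rooted binary tree whose root has two child subtrees with leaf sets $B_1$ and $B_2$ respectively (of arbitrary topology), attached via the same split edge. Then $g_k(\mathcal{T}) \geq g_k(\mathcal{T}')$.
   Context: A tree (unrooted binary phylogenetic $X$-tree) is a finite unrooted tree in which every internal vertex has degree 3 and whose leaves are bijectively labelled by a finite set $X$ of taxa. A bipartition $A|B$ of $X$ is a split of $\mathcal{T}$ if deleting a single edge $e$ of $\mathcal{T}$ leaves two components whose taxa sets are $A$ and $B$; the component containing $B$ is the pendant $B$ subtree. A character on $X$ is a partition of $X$ into non-empty blocks (states); it is convex on $\mathcal{T}$ if the minimal subtrees of $\mathcal{T}$ spanning distinct states are vertex-disjoint. $g_k(\mathcal{T})$ is the number of convex characters on $\mathcal{T}$ all of whose states have at least $k$ taxa. (The replacement subtree is exactly a fully $k$-loaded tree on $B$ whose scaffold is a single edge, attached at a subdivision of that edge.) -}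

module Defs where

open import Data.Nat using (ℕ; zero; suc; _≤_; _≤?_)
open import Data.Fin using (Fin; toℕ; _≟_)
open import Data.Fin.Properties using (all?; any?)
open import Data.List using (List; []; _∷_; _++_; length; filter; map; concatMap; allFin; [_])
open import Data.List.Relation.Unary.Any as Any using (Any)
open import Data.List.Relation.Unary.All as All using (All)
open import Data.List.Membership.Propositional using (_∉_)
import Data.List.Membership.DecPropositional as DecMem
open import Data.List.Relation.Binary.Permutation.Propositional using (_↭_; ↭-trans)
open import Data.List.Relation.Binary.Permutation.Propositional.Properties using (++⁺ˡ)
open import Data.Vec.Functional using (Vector) renaming (_∷_ to _∷ᶠ_)
open import Data.Product using (_×_; _,_; ∃; proj₁; proj₂)
open import Data.Sum using (_⊎_)
open import Relation.Binary.PropositionalEquality using (_≡_)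
open import Relation.Nullary using (Dec; ¬?)
open import Relation.Nullary.Decidable using (_×-dec_; _⊎-dec_; _→-dec_)

data RTree (n : ℕ) : Set where
  leaf : Fin n → RTree n
  node : RTree n → RTree n → RTree n

leaves : ∀ {n} → RTree n → List (Fin n)
leaves (leaf x)   = [ x ]
leaves (node a b) = leaves a ++ leaves b

-- An unrooted binary phylogenetic X-tree (X = Fin n) together with a
-- distinguished edge e: deleting e leaves two rooted binary trees
-- side₁ and side₂ (rooted at the endpoints of e).  Every internal
-- vertex then has degree 3.  The leaves are bijectively labelled by X.
-- The split of e is  leaves side₁ | leaves side₂ , and side₂ is the
-- pendant subtree on the second part.

record XTree (n : ℕ) : Set where
  constructor mkXTree
  field
    side₁     : RTree n
    side₂     : RTree n
    labelling : (leaves side₁ ++ leaves side₂) ↭ allFin n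
open XTree public

-- Internal vertices of the tree: each is a node  node a b  of side₁ or
-- side₂; deleting it leaves three components with taxa sets
-- leaves a, leaves b, and X minus both.  We record the first two.
internalsR : ∀ {n} → RTree n → List (List (Fin n) × List (Fin n))
internalsR (leaf x)   = []
internalsR (node a b) = (leaves a , leaves b) ∷ (internalsR a ++ internalsR b)

internals : ∀ {n} → XTree n → List (List (Fin n) × List (Fin n))
internals T = internalsR (side₁ T) ++ internalsR (side₂ T)

-- A character (partition of X into non-empty blocks) is
-- encoded canonically by the map χ sending each taxon to the least
-- taxon of its block: χ i ≤ i and χ (χ i) = χ i.  The states (blocks)
-- are the fibres  {i ∣ χ i ≡ r}  for r with χ r ≡ r.

Character : ℕ → Set
Character n = Fin n → Fin n

IsCanonical : ∀ {n} → Character n → Set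
IsCanonical {n} χ = (i : Fin n) → (toℕ (χ i) ≤ toℕ i) × (χ (χ i) ≡ χ i)

IsState : ∀ {n} → Character n → Fin n → Set
IsState χ r = χ r ≡ r

blockSize : ∀ {n} → Character n → Fin n → ℕ
blockSize {n} χ r = length (filter (λ i → χ i ≟ r) (allFin n))

AllStatesAtLeast : ∀ {n} → ℕ → Character n → Set
AllStatesAtLeast {n} k χ = (r : Fin n) → IsState χ r → k ≤ blockSize χ r

Meets : ∀ {n} → Character n → Fin n → List (Fin n) → Set
Meets χ r C = Any (λ i → χ i ≡ r) C

MeetsRest : ∀ {n} → Character n → Fin n → List (Fin n) → List (Fin n) → Set
MeetsRest χ r C₁ C₂ = ∃ λ i → (i ∉ C₁) × (i ∉ C₂) × (χ i ≡ r)

-- An internal vertex v lies on the minimal subtree spanning state r iff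
-- r meets at least two of the three components of T - v.
-- (A leaf lies on that subtree iff its taxon is in r, so leaves are
-- never shared between two distinct states.)
InSpan : ∀ {n} → Character n → Fin n → List (Fin n) × List (Fin n) → Set
InSpan χ r (C₁ , C₂) =
  (Meets χ r C₁ × Meets χ r C₂) ⊎
  (Meets χ r C₁ × MeetsRest χ r C₁ C₂) ⊎
  (Meets χ r C₂ × MeetsRest χ r C₁ C₂)

-- convex: minimal spanning subtrees of distinct states are vertex-disjoint
Convex : ∀ {n} → XTree n → Character n → Set
Convex {n} T χ =
  All (λ v → (r s : Fin n) → IsState χ r → IsState χ s →
             InSpan χ r v → InSpan χ s v → r ≡ s)
      (internals T)

Counted : ∀ {n} → ℕ → XTree n → Character n → Set
Counted k T χ = IsCanonical χ × AllStatesAtLeast k χ × Convex T χ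

meets? : ∀ {n} (χ : Character n) r C → Dec (Meets χ r C)
meets? χ r C = Any.any? (λ i → χ i ≟ r) C

meetsRest? : ∀ {n} (χ : Character n) r C₁ C₂ → Dec (MeetsRest χ r C₁ C₂)
meetsRest? χ r C₁ C₂ =
  any? (λ i → ¬? (DecMem._∈?_ _≟_ i C₁) ×-dec ¬? (DecMem._∈?_ _≟_ i C₂) ×-dec (χ i ≟ r))

inSpan? : ∀ {n} (χ : Character n) r v → Dec (InSpan χ r v)
inSpan? χ r (C₁ , C₂) =
  (meets? χ r C₁ ×-dec meets? χ r C₂) ⊎-dec
  (meets? χ r C₁ ×-dec meetsRest? χ r C₁ C₂) ⊎-dec
  (meets? χ r C₂ ×-dec meetsRest? χ r C₁ C₂)

counted? : ∀ {n} k (T : XTree n) (χ : Character n) → Dec (Counted k T χ)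
counted? k T χ =
  all? (λ i → (toℕ (χ i) ≤? toℕ i) ×-dec (χ (χ i) ≟ χ i)) ×-dec
  all? (λ r → (χ r ≟ r) →-dec (k ≤? blockSize χ r)) ×-dec
  All.all? (λ v → all? (λ r → all? (λ s →
              (χ r ≟ r) →-dec (χ s ≟ s) →-dec
              inSpan? χ r v →-dec inSpan? χ s v →-dec (r ≟ s))))
           (internals T)

allMaps : ∀ {c} m → List (Vector (Fin c) m)
allMaps zero    = [ (λ ()) ]
allMaps {c} (suc m) = concatMap (λ x → map (x ∷ᶠ_) (allMaps m)) (allFin c)

g : ∀ {n} → ℕ → XTree n → ℕ
g {n} k T = length (filter (counted? k T) (allMaps n))

replace : ∀ {n} (T : XTree n) (T₁ T₂ : RTree n) →
          (leaves T₁ ++ leaves T₂) ↭ leaves (side₂ T) → XTree n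
replace T T₁ T₂ p =
  mkXTree (side₁ T) (node T₁ T₂)
          (↭-trans (++⁺ˡ (leaves (side₁ T)) p) (labelling T))

{-# OPTIONS --safe #-}
-- Every character counted on T′ is already counted on T.  A state with at least k
-- taxa cannot lie inside a pendant subtree with fewer than k taxa, so convexity at
-- the root of such a subtree forces one state on all of its leaves; by induction
-- both B₁ and B₂ are monochromatic.  At the root joining them, each of the two
-- states must either reach the other side or leave B entirely, and in the latter
-- case both would span that vertex; either way they coincide.  A monochromatic B
-- makes every vertex of any pendant B subtree convex, in particular that of T.
module Submission where

open import Defs
open import Data.Nat using (ℕ; suc; _≤_; _<_; _≥_; _+_; _*_; _∸_; z≤n; s≤s)
open import Data.Nat.Properties
  using (≤-trans; ≤-<-trans; ≤-reflexive; <⇒≱; m≤m+n; m≤n+m; +-cancelˡ-≤; +-identityʳ; module ≤-Reasoning)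
open import Data.Fin using (Fin; _≟_)
open import Data.Fin.Properties using (any?)
open import Data.List using (List; []; _∷_; _++_; length; filter; allFin)
open import Data.List.Properties using (length-++; length-removeAt′)
open import Data.List.Membership.Propositional using (_∈_; _∉_; find)
open import Data.List.Membership.Propositional.Properties
  using (∈-++⁺ˡ; ∈-++⁺ʳ; ∈-++⁻; ∈-filter⁻)
import Data.List.Membership.DecPropositional as DecMembership
open import Data.List.Relation.Unary.Any as Any using (Any; here; there; _─_)
open import Data.List.Relation.Unary.Any.Properties using (++⁺ˡ; ++⁺ʳ)
open import Data.List.Relation.Unary.All as All using (All; []; _∷_)
open import Data.List.Relation.Unary.All.Properties using (++⁺; ++⁻)
open import Data.List.Relation.Unary.AllPairs using (_∷_)
open import Data.List.Relation.Unary.Unique.Propositional using (Unique)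
import Data.List.Relation.Unary.Unique.Propositional.Properties as Unique
open import Data.List.Relation.Binary.Subset.Propositional using (_⊆_)
import Data.List.Relation.Binary.Sublist.Propositional as Sublist
import Data.List.Relation.Binary.Sublist.Propositional.Properties as Sublist
open import Data.List.Relation.Binary.Permutation.Propositional using (_↭_; ↭-sym)
open import Data.List.Relation.Binary.Permutation.Propositional.Properties using (∈-resp-↭; ↭-length)
open import Data.Product using (_×_; _,_; ∃; proj₁; proj₂)
open import Data.Sum using (inj₁; inj₂)
open import Relation.Nullary using (Dec; yes; no; ¬?; contradiction)
open import Relation.Nullary.Decidable using (_×-dec_)
open import Relation.Binary.PropositionalEquality using (_≡_; _≢_; refl; sym; trans; cong)

module _ {a} {A : Set a} where

  ∈-─⁺ : ∀ {x y : A} {ys} (x∈ys : x ∈ ys) → y ∈ ys → y ≢ x → y ∈ (ys ─ x∈ys)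
  ∈-─⁺ (here refl) (here refl) y≢x = contradiction refl y≢x
  ∈-─⁺ (here refl) (there y∈ys) _  = y∈ys
  ∈-─⁺ (there _)   (here refl)  _  = here refl
  ∈-─⁺ (there x∈ys) (there y∈ys) y≢x = there (∈-─⁺ x∈ys y∈ys y≢x)

  Unique-⊆⇒length-≤ : ∀ {xs ys : List A} → Unique xs → xs ⊆ ys → length xs ≤ length ys
  Unique-⊆⇒length-≤ {[]}     _              _  = z≤n
  Unique-⊆⇒length-≤ {x ∷ xs} {ys} (x∉xs ∷ u) xs⊆ys = begin
    suc (length xs)               ≤⟨ s≤s (Unique-⊆⇒length-≤ u xs⊆ys─x) ⟩
    suc (length (ys ─ x∈ys))      ≡⟨ length-removeAt′ ys (Any.index x∈ys) ⟨
    length ys                     ∎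
    where
    open ≤-Reasoning
    x∈ys : x ∈ ys
    x∈ys = xs⊆ys (here refl)
    xs⊆ys─x : xs ⊆ (ys ─ x∈ys)
    xs⊆ys─x y∈xs = ∈-─⁺ x∈ys (xs⊆ys (there y∈xs)) (λ y≡x → All.lookup x∉xs y∈xs (sym y≡x))

  length-filter-mono : ∀ {p q} {P : A → Set p} {Q : A → Set q}
                       (P? : ∀ x → Dec (P x)) (Q? : ∀ x → Dec (Q x)) →
                       (∀ {x} → P x → Q x) → (xs : List A) →
                       length (filter P? xs) ≤ length (filter Q? xs)
  length-filter-mono P? Q? P⇒Q xs =
    Sublist.length-mono-≤ (Sublist.filter⁺ P? Q? (λ { refl → P⇒Q }) (Sublist.⊆-refl {x = xs}))

module _ {n : ℕ} where

  open DecMembership {A = Fin n} _≟_ using (_∈?_)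

  ConvexAt : Character n → List (Fin n) × List (Fin n) → Set
  ConvexAt χ v = (r s : Fin n) → IsState χ r → IsState χ s →
                 InSpan χ r v → InSpan χ s v → r ≡ s

  Monochromatic : Character n → List (Fin n) → Set
  Monochromatic χ C = ∀ {i j} → i ∈ C → j ∈ C → χ i ≡ χ j

  monochromatic-⊆ : ∀ {χ C D} → C ⊆ D → Monochromatic χ D → Monochromatic χ C
  monochromatic-⊆ C⊆D mono i∈C j∈C = mono (C⊆D i∈C) (C⊆D j∈C)

  g-mono : ∀ k (T T′ : XTree n) → (∀ χ → Counted k T′ χ → Counted k T χ) → g k T′ ≤ g k T
  g-mono k T T′ T′⇒T = length-filter-mono (counted? k T′) (counted? k T) (T′⇒T _) (allMaps n)

  blockSize-≤ : ∀ χ r {L} → (∀ {m} → χ m ≡ r → m ∈ L) → blockSize χ r ≤ length L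
  blockSize-≤ χ r block⊆L =
    Unique-⊆⇒length-≤ (Unique.filter⁺ (λ i → χ i ≟ r) (Unique.allFin⁺ n))
      (λ m∈block → block⊆L (proj₂ (∈-filter⁻ (λ i → χ i ≟ r) {xs = allFin n} m∈block)))

  large-block-escapes : ∀ {k} χ r L → k ≤ blockSize χ r → length L < k → ∃ λ m → χ m ≡ r × m ∉ L
  large-block-escapes χ r L large small with any? (λ m → (χ m ≟ r) ×-dec ¬? (m ∈? L))
  ... | yes escape = escape
  ... | no ¬escape = contradiction (≤-trans large (blockSize-≤ χ r block⊆L)) (<⇒≱ small)
    where
    block⊆L : ∀ {m} → χ m ≡ r → m ∈ L
    block⊆L {m} χm≡r with m ∈? L
    ... | yes m∈L = m∈L
    ... | no  m∉L = contradiction (m , χm≡r , m∉L) ¬escape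

  monochromatic-++ : ∀ {χ C₁ C₂} → Monochromatic χ C₁ → Monochromatic χ C₂ →
                     (∀ {i j} → i ∈ C₁ → j ∈ C₂ → χ i ≡ χ j) → Monochromatic χ (C₁ ++ C₂)
  monochromatic-++ {C₁ = C₁} mono₁ mono₂ across i∈ j∈ with ∈-++⁻ C₁ i∈ | ∈-++⁻ C₁ j∈
  ... | inj₁ i∈C₁ | inj₁ j∈C₁ = mono₁ i∈C₁ j∈C₁
  ... | inj₁ i∈C₁ | inj₂ j∈C₂ = across i∈C₁ j∈C₂
  ... | inj₂ i∈C₂ | inj₁ j∈C₁ = sym (across j∈C₁ i∈C₂)
  ... | inj₂ i∈C₂ | inj₂ j∈C₂ = mono₂ i∈C₂ j∈C₂

  ∈⇒meets : ∀ (χ : Character n) {i C} → i ∈ C → Meets χ (χ i) C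
  ∈⇒meets χ i∈C = Any.map (λ i≡x → cong χ (sym i≡x)) i∈C

  monochromatic-meets : ∀ (χ : Character n) {C r s} →
                        Monochromatic χ C → Meets χ r C → Meets χ s C → r ≡ s
  monochromatic-meets χ mono r-meets s-meets =
    let i , i∈C , χi≡r = find r-meets
        j , j∈C , χj≡s = find s-meets
    in trans (sym χi≡r) (trans (mono i∈C j∈C) χj≡s)

  inSpan⇒meets : ∀ (χ : Character n) {r} C₁ C₂ → InSpan χ r (C₁ , C₂) → Meets χ r (C₁ ++ C₂)
  inSpan⇒meets χ C₁ C₂ (inj₁ (meets₁ , _))         = ++⁺ˡ meets₁
  inSpan⇒meets χ C₁ C₂ (inj₂ (inj₁ (meets₁ , _)))  = ++⁺ˡ meets₁
  inSpan⇒meets χ C₁ C₂ (inj₂ (inj₂ (meets₂ , _)))  = ++⁺ʳ C₁ meets₂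

  monochromatic⇒convex : ∀ {χ} (t : RTree n) →
                         Monochromatic χ (leaves t) → All (ConvexAt χ) (internalsR t)
  monochromatic⇒convex (leaf _)   _    = []
  monochromatic⇒convex {χ} (node a b) mono =
    convex-root ∷ ++⁺ (monochromatic⇒convex a (monochromatic-⊆ ∈-++⁺ˡ mono))
                      (monochromatic⇒convex b (monochromatic-⊆ (∈-++⁺ʳ (leaves a)) mono))
    where
    convex-root : ConvexAt χ (leaves a , leaves b)
    convex-root r s _ _ r-span s-span =
      monochromatic-meets χ mono (inSpan⇒meets χ (leaves a) (leaves b) r-span)
                                 (inSpan⇒meets χ (leaves a) (leaves b) s-span)

  module _ {k : ℕ} {χ : Character n} (canonical : IsCanonical χ) (large : AllStatesAtLeast k χ) where

    state-escapes : ∀ i L → length L < k → ∃ λ m → χ m ≡ χ i × m ∉ L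
    state-escapes i L = large-block-escapes χ (χ i) L (large (χ i) (proj₂ (canonical i)))

    convex-join : ∀ {C₁ C₂} → ConvexAt χ (C₁ , C₂) → length C₁ < k → length C₂ < k →
                  Monochromatic χ C₁ → Monochromatic χ C₂ →
                  ∀ {i j} → i ∈ C₁ → j ∈ C₂ → χ i ≡ χ j
    convex-join {C₁} {C₂} convex small₁ small₂ mono₁ mono₂ {i} {j} i∈C₁ j∈C₂
      with m , χm≡χi , m∉C₁ ← state-escapes i C₁ small₁ | m ∈? C₂
    ... | yes m∈C₂ = trans (sym χm≡χi) (mono₂ m∈C₂ j∈C₂)
    ... | no  m∉C₂ with m′ , χm′≡χj , m′∉C₂ ← state-escapes j C₂ small₂ | m′ ∈? C₁
    ... | yes m′∈C₁ = trans (mono₁ i∈C₁ m′∈C₁) χm′≡χj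
    ... | no  m′∉C₁ =
      convex (χ i) (χ j) (proj₂ (canonical i)) (proj₂ (canonical j))
        (inj₂ (inj₁ (∈⇒meets χ i∈C₁ , m , m∉C₁ , m∉C₂ , χm≡χi)))
        (inj₂ (inj₂ (∈⇒meets χ j∈C₂ , m′ , m′∉C₁ , m′∉C₂ , χm′≡χj)))

    small-convex⇒monochromatic : (t : RTree n) → length (leaves t) < k →
                                 All (ConvexAt χ) (internalsR t) → Monochromatic χ (leaves t)
    small-children⇒monochromatic : (a b : RTree n) →
                                   length (leaves a) < k → length (leaves b) < k →
                                   All (ConvexAt χ) (internalsR (node a b)) → Monochromatic χ (leaves (node a b))

    small-convex⇒monochromatic (leaf _)   _     _      (here refl) (here refl) = refl
    small-convex⇒monochromatic (node a b) small convex =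
      small-children⇒monochromatic a b
        (≤-<-trans (m≤m+n _ _) small-ab) (≤-<-trans (m≤n+m _ _) small-ab) convex
      where
      small-ab : length (leaves a) + length (leaves b) < k
      small-ab = ≤-<-trans (≤-reflexive (sym (length-++ (leaves a)))) small

    small-children⇒monochromatic a b small-a small-b (convex-root ∷ convex-below) =
      monochromatic-++ mono-a mono-b (convex-join convex-root small-a small-b mono-a mono-b)
      where
      mono-a : Monochromatic χ (leaves a)
      mono-a = small-convex⇒monochromatic a small-a (proj₁ (++⁻ (internalsR a) convex-below))
      mono-b : Monochromatic χ (leaves b)
      mono-b = small-convex⇒monochromatic b small-b (proj₂ (++⁻ (internalsR a) convex-below))

    convex-replace⇒convex : (T : XTree n) (T₁ T₂ : RTree n)
                            (p : leaves T₁ ++ leaves T₂ ↭ leaves (side₂ T)) →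
                            length (leaves T₁) < k → length (leaves T₂) < k →
                            Convex (replace T T₁ T₂ p) χ → Convex T χ
    convex-replace⇒convex T T₁ T₂ p small₁ small₂ convex =
      ++⁺ convex-side₁ (monochromatic⇒convex (side₂ T) (monochromatic-⊆ (∈-resp-↭ (↭-sym p)) mono-B))
      where
      convex-side₁ : All (ConvexAt χ) (internalsR (side₁ T))
      convex-side₁ = proj₁ (++⁻ (internalsR (side₁ T)) convex)
      mono-B : Monochromatic χ (leaves T₁ ++ leaves T₂)
      mono-B = small-children⇒monochromatic T₁ T₂ small₁ small₂
                 (proj₂ (++⁻ (internalsR (side₁ T)) convex))

lemma4p5 : (k n : ℕ) → 2 ≤ k → (T : XTree n) →
             k ≤ length (leaves (side₂ T)) →
             length (leaves (side₂ T)) ≤ 2 * (k ∸ 1) →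
             (T₁ T₂ : RTree n) →
             (p : (leaves T₁ ++ leaves T₂) ↭ leaves (side₂ T)) →
             length (leaves T₁) ≡ k ∸ 1 →
             g k T ≥ g k (replace T T₁ T₂ p)
lemma4p5 (suc k) n (s≤s _) T _ |B|≤2k T₁ T₂ p |B₁|≡k =
  g-mono (suc k) T (replace T T₁ T₂ p) λ χ (canonical , large , convex) →
    canonical , large , convex-replace⇒convex canonical large T T₁ T₂ p small₁ small₂ convex
  where
  open ≤-Reasoning
  small₁ : length (leaves T₁) < suc k
  small₁ = s≤s (≤-reflexive |B₁|≡k)
  small₂ : length (leaves T₂) < suc k
  small₂ = s≤s (+-cancelˡ-≤ k _ _ (begin
    k + length (leaves T₂)                   ≡⟨ cong (_+ length (leaves T₂)) |B₁|≡k ⟨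
    length (leaves T₁) + length (leaves T₂)  ≡⟨ length-++ (leaves T₁) ⟨
    length (leaves T₁ ++ leaves T₂)          ≡⟨ ↭-length p ⟩
    length (leaves (side₂ T))                ≤⟨ |B|≤2k ⟩
    2 * k                                    ≡⟨ cong (k +_) (+-identityʳ k) ⟩
    k + k                                    ∎))
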